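{- Let $k\ge2$, $n,N\ge1$, let $A:[n]^k\to[N]$ be a function and let $S\subseteq[n]^k$. Then $$D_k(A,S)\le (k-1)2^{N_k(A,S)}+N_k(A,S).$$
   Context: NOF model with $k$ players: the input is $(x_1,\ldots,x_k)$, and player $i$ sees all $x_j$ with $j\neq i$ but not $x_i$. The players write bits in turns on a shared blackboard; each bit depends on what the writer sees and on the blackboard so far. The cost of a protocol is the maximum over the relevant inputs of the number of bits written (including proof bits in the nondeterministic case). For $S\subseteq[n]^k$, $D_k(A,S)$ is the minimum cost of a deterministic NOF protocol that, on every input in $S$, ends with all players knowing $A(x_1,\ldots,x_k)$; behaviour outside $S$ is unrestricted. $N_k(A,S)$ is the nondeterministic analogue. The players additionally see a proof string from an all-powerful prover and output a value in $[N]$ or "don't know". On every input in $S$ the output is never a wrong value, and some proof string yields the correct value $A(x_1,\ldots,x_k)$. Nothing is required on inputs outside $S$. -}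

module Defs where

open import Data.Nat using (ℕ; _+_; _≤_)
open import Data.Fin using (Fin)
open import Data.Bool using (Bool; true; false)
open import Data.Maybe using (Maybe; just; nothing)
open import Data.Vec using (Vec)
open import Data.Product using (Σ; ∃; _×_)
open import Data.Sum using (_⊎_)
open import Relation.Binary.PropositionalEquality using (_≡_; _≢_)

Input : ℕ → ℕ → Set
Input k n = Fin k → Fin n

SameView : ∀ {k n} → Fin k → Input k n → Input k n → Set
SameView {k} i x y = ∀ (j : Fin k) → j ≢ i → x j ≡ y j

Visible : ∀ {k n} → Fin k → (Input k n → Bool) → Set
Visible i b = ∀ x y → SameView i x y → b x ≡ b y

-- A node is the current blackboard
-- contents; it names the player i who writes next and the bit function
-- (computed from what i sees; the blackboard so far is encoded by the
-- position in the tree).  A leaf is the end of the protocol and carries the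
-- output, which is determined by the blackboard, hence known to all players.
data Protocol (k n : ℕ) (O : Set) : Set where
  leaf : O → Protocol k n O
  node : (i : Fin k) (b : Input k n → Bool) → Visible i b →
         (ifTrue ifFalse : Protocol k n O) → Protocol k n O

run : ∀ {k n O} → Protocol k n O → Input k n → O
run (leaf o) x = o
run (node i b _ t f) x with b x
... | true  = run t x
... | false = run f x

bits : ∀ {k n O} → Protocol k n O → Input k n → ℕ
bits (leaf o) x = 0
bits (node i b _ t f) x with b x
... | true  = 1 + bits t x
... | false = 1 + bits f x

DetSolves : ∀ {k n N} → (Input k n → Fin N) → (Input k n → Set) →
            Protocol k n (Fin N) → ℕ → Set
DetSolves A S P d = ∀ x → S x → run P x ≡ A x × bits P x ≤ d

HasDetCost : ∀ {k n N} → (Input k n → Fin N) → (Input k n → Set) → ℕ → Set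
HasDetCost {k} {n} {N} A S d = Σ (Protocol k n (Fin N)) λ P → DetSolves A S P d

IsD : ∀ {k n N} → (Input k n → Fin N) → (Input k n → Set) → ℕ → Set
IsD A S d = HasDetCost A S d × (∀ d′ → HasDetCost A S d′ → d ≤ d′)

-- A proof of p bits is given to all players; for each proof string the
-- players run a protocol whose output is a value in [N] or "don't know"
-- (nothing).
record NProtocol (k n N : ℕ) : Set where
  constructor nprot
  field
    proofLen : ℕ
    prot     : Vec Bool proofLen → Protocol k n (Maybe (Fin N))
open NProtocol public

NondetSolves : ∀ {k n N} → (Input k n → Fin N) → (Input k n → Set) →
               NProtocol k n N → ℕ → Set
NondetSolves A S P c =
  ∀ x → S x →
    (∀ π → (run (prot P π) x ≡ nothing ⊎ run (prot P π) x ≡ just (A x))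
           × proofLen P + bits (prot P π) x ≤ c)
    × (∃ λ π → run (prot P π) x ≡ just (A x))

HasNondetCost : ∀ {k n N} → (Input k n → Fin N) → (Input k n → Set) → ℕ → Set
HasNondetCost {k} {n} {N} A S c = Σ (NProtocol k n N) λ P → NondetSolves A S P c

IsN : ∀ {k n N} → (Input k n → Fin N) → (Input k n → Set) → ℕ → Set
IsN A S c = HasNondetCost A S c × (∀ c′ → HasNondetCost A S c′ → c ≤ c′)

-- Flatten a nondeterministic protocol of cost c into certificates
-- w = proof ++ transcript ∈ {0,1}^c.  Player i accepts w on x if every bit
-- of w written at one of i's nodes is the bit i would write on x; this
-- depends only on what i sees, and when all players accept w, the path of w
-- is the actual run of the protocol on the proof, so the value at its end is
-- never wrong.  Deterministically, each of the players 2,…,k writes its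
-- acceptance bit for every certificate, (k-1)·2^c bits in all.  Player 1 can
-- then see which certificates everybody accepts and ends in a value, and
-- writes one of them (c bits); its value is the output.
module Submission where

open import Defs
open import Data.Nat using (ℕ; zero; suc; _+_; _*_; _∸_; _^_; _≤_; s≤s; _≤?_)
open import Data.Nat.Properties
  using (+-assoc; +-identityʳ; +-cancelˡ-≤; ≤-reflexive; m≤n⇒∃[o]m+o≡n; m≤m+n; ≤-trans)
open import Data.Fin using (Fin; zero; suc) renaming (_≟_ to _≟ᶠ_)
open import Data.Bool using (Bool; true; false; T; _∧_; if_then_else_) renaming (_≟_ to _≟ᵇ_)
open import Data.Bool.Properties using (T-∧; T-≡)
open import Data.Maybe using (Maybe; just; nothing; fromMaybe; is-just)
open import Data.Vec using (Vec; []; _∷_; head; tail; tabulate; _++_; take; drop; replicate)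
open import Data.Product using (Σ; ∃; _×_; _,_; proj₁; proj₂)
open import Data.Sum using (_⊎_; inj₁; inj₂)
open import Data.Empty using (⊥-elim)
open import Data.Unit using (tt)
open import Function using (_∘_; Equivalence)
open import Relation.Nullary using (¬_; does; yes; no)
open import Relation.Binary.PropositionalEquality

open Equivalence using (to; from)

private
  variable
    k n N c m : ℕ
    O : Set

ComputableBy : {B : Set} → Fin k → (Input k n → B) → Set
ComputableBy i f = ∀ x y → SameView i x y → f x ≡ f y

take-++ : {A : Set} (xs : Vec A m) (ys : Vec A n) → take m (xs ++ ys) ≡ xs
take-++ []       ys = refl
take-++ (x ∷ xs) ys = cong (x ∷_) (take-++ xs ys)

drop-++ : {A : Set} (xs : Vec A m) (ys : Vec A n) → drop m (xs ++ ys) ≡ ys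
drop-++ []       ys = refl
drop-++ (x ∷ xs) ys = drop-++ xs ys

choose : (Vec Bool c → Bool) → Vec Bool c
choose {zero}  p = []
choose {suc c} p =
  if p (true ∷ choose (p ∘ (true ∷_)))
    then true ∷ choose (p ∘ (true ∷_))
    else false ∷ choose (p ∘ (false ∷_))

choose-spec : (p : Vec Bool c → Bool) (w : Vec Bool c) → T (p w) → T (p (choose p))
choose-spec {zero} p [] pw = pw
choose-spec {suc c} p (h ∷ w) pw with p (true ∷ choose (p ∘ (true ∷_))) in eq
... | true = from T-≡ eq
choose-spec {suc c} p (true ∷ w) pw | false =
  ⊥-elim (subst T eq (choose-spec (p ∘ (true ∷_)) w pw))
choose-spec {suc c} p (false ∷ w) pw | false = choose-spec (p ∘ (false ∷_)) w pw

choose-cong : {p q : Vec Bool c → Bool} → (∀ w → p w ≡ q w) → choose p ≡ choose q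
choose-cong {zero} e = refl
choose-cong {suc c} {p} {q} e
  rewrite choose-cong {p = p ∘ (true ∷_)} {q ∘ (true ∷_)} (e ∘ (true ∷_))
        | choose-cong {p = p ∘ (false ∷_)} {q ∘ (false ∷_)} (e ∘ (false ∷_))
        | e (true ∷ choose (q ∘ (true ∷_))) = refl

table : ∀ c → (Vec Bool c → Bool) → Vec Bool (2 ^ c)
table zero    p = p [] ∷ []
table (suc c) p = table c (p ∘ (true ∷_)) ++ (table c (p ∘ (false ∷_)) ++ [])

entry : ∀ c → Vec Bool (2 ^ c) → Vec Bool c → Bool
entry zero    t []          = head t
entry (suc c) t (true ∷ w)  = entry c (take (2 ^ c) t) w
entry (suc c) t (false ∷ w) = entry c (take (2 ^ c) (drop (2 ^ c) t)) w

entry-table : ∀ c (p : Vec Bool c → Bool) w → entry c (table c p) w ≡ p w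
entry-table zero    p []          = refl
entry-table (suc c) p (true ∷ w)
  rewrite take-++ (table c (p ∘ (true ∷_))) (table c (p ∘ (false ∷_)) ++ []) =
  entry-table c (p ∘ (true ∷_)) w
entry-table (suc c) p (false ∷ w)
  rewrite drop-++ (table c (p ∘ (true ∷_))) (table c (p ∘ (false ∷_)) ++ [])
        | take-++ (table c (p ∘ (false ∷_))) [] =
  entry-table c (p ∘ (false ∷_)) w

table-cong : ∀ c {p q : Vec Bool c → Bool} → (∀ w → p w ≡ q w) → table c p ≡ table c q
table-cong zero    e = cong (_∷ []) (e [])
table-cong (suc c) e =
  cong₂ (λ u v → u ++ (v ++ [])) (table-cong c (e ∘ (true ∷_))) (table-cong c (e ∘ (false ∷_)))

allᵇ : {B : Set} → (B → Bool) → Vec B m → Bool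
allᵇ p []       = true
allᵇ p (b ∷ bs) = p b ∧ allᵇ p bs

allᵇ-tabulate : {B : Set} (p : B → Bool) (f : Fin m → B) →
                T (allᵇ p (tabulate f)) → ∀ j → T (p (f j))
allᵇ-tabulate p f h zero    = proj₁ (to T-∧ h)
allᵇ-tabulate p f h (suc j) = allᵇ-tabulate p (f ∘ suc) (proj₂ (to T-∧ h)) j

tabulate-allᵇ : {B : Set} (p : B → Bool) (f : Fin m → B) →
                (∀ j → T (p (f j))) → T (allᵇ p (tabulate f))
tabulate-allᵇ {m = zero}  p f h = tt
tabulate-allᵇ {m = suc m} p f h = from T-∧ (h zero , tabulate-allᵇ p (f ∘ suc) (h ∘ suc))

writeBit : (i : Fin k) (b : Input k n → Bool) → Visible i b →
           (Bool → Protocol k n O) → Protocol k n O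
writeBit i b v K = node i b v (K true) (K false)

run-writeBit : ∀ (i : Fin k) b v (K : Bool → Protocol k n O) x →
               run (writeBit i b v K) x ≡ run (K (b x)) x
run-writeBit i b v K x with b x
... | true  = refl
... | false = refl

bits-writeBit : ∀ (i : Fin k) b v (K : Bool → Protocol k n O) x →
                bits (writeBit i b v K) x ≡ suc (bits (K (b x)) x)
bits-writeBit i b v K x with b x
... | true  = refl
... | false = refl

computable-∘ : {B D : Set} {i : Fin k} {f : Input k n → B} (g : B → D) →
               ComputableBy i f → ComputableBy i (g ∘ f)
computable-∘ g vis x y e = cong g (vis x y e)

writeBits : (i : Fin k) (f : Input k n → Vec Bool c) → ComputableBy i f →
            (Vec Bool c → Protocol k n O) → Protocol k n O
writeBits {c = zero}  i f vis K = K []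
writeBits {c = suc c} i f vis K =
  writeBit i (head ∘ f) (computable-∘ head vis) λ h →
    writeBits i (tail ∘ f) (computable-∘ tail vis) (K ∘ (h ∷_))

head∷tail : {B : Set} (v : Vec B (suc m)) → head v ∷ tail v ≡ v
head∷tail (b ∷ v) = refl

run-writeBits : ∀ (i : Fin k) (f : Input k n → Vec Bool c) vis
                (K : Vec Bool c → Protocol k n O) x →
                run (writeBits i f vis K) x ≡ run (K (f x)) x
run-writeBits {c = zero}  i f vis K x with f x
... | [] = refl
run-writeBits {c = suc c} i f vis K x =
  trans (run-writeBit i (head ∘ f) (computable-∘ head vis)
           (λ h → writeBits i (tail ∘ f) tail-vis (K ∘ (h ∷_))) x)
    (trans (run-writeBits i (tail ∘ f) tail-vis (K ∘ (head (f x) ∷_)) x)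
           (cong (λ w → run (K w) x) (head∷tail (f x))))
  where tail-vis = computable-∘ tail vis

bits-writeBits : ∀ (i : Fin k) (f : Input k n → Vec Bool c) vis
                 (K : Vec Bool c → Protocol k n O) x →
                 bits (writeBits i f vis K) x ≡ c + bits (K (f x)) x
bits-writeBits {c = zero}  i f vis K x with f x
... | [] = refl
bits-writeBits {c = suc c} i f vis K x =
  trans (bits-writeBit i (head ∘ f) (computable-∘ head vis)
           (λ h → writeBits i (tail ∘ f) tail-vis (K ∘ (h ∷_))) x)
    (cong suc (trans (bits-writeBits i (tail ∘ f) tail-vis (K ∘ (head (f x) ∷_)) x)
                     (cong (λ w → c + bits (K w) x) (head∷tail (f x)))))
  where tail-vis = computable-∘ tail vis

writeInTurn : ∀ {L} m (ρ : Fin m → Fin k) (f : Fin m → Input k n → Vec Bool L) →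
              (∀ j → ComputableBy (ρ j) (f j)) →
              (Vec (Vec Bool L) m → Protocol k n O) → Protocol k n O
writeInTurn zero    ρ f vis K = K []
writeInTurn (suc m) ρ f vis K =
  writeBits (ρ zero) (f zero) (vis zero) λ w →
    writeInTurn m (ρ ∘ suc) (f ∘ suc) (vis ∘ suc) (K ∘ (w ∷_))

run-writeInTurn : ∀ {L} m ρ (f : Fin m → Input k n → Vec Bool L) vis
                  (K : Vec (Vec Bool L) m → Protocol k n O) x →
                  run (writeInTurn m ρ f vis K) x ≡ run (K (tabulate (λ j → f j x))) x
run-writeInTurn zero    ρ f vis K x = refl
run-writeInTurn (suc m) ρ f vis K x =
  trans (run-writeBits (ρ zero) (f zero) (vis zero) _ x)
        (run-writeInTurn m (ρ ∘ suc) (f ∘ suc) (vis ∘ suc) (K ∘ (f zero x ∷_)) x)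

bits-writeInTurn : ∀ {L} m ρ (f : Fin m → Input k n → Vec Bool L) vis
                   (K : Vec (Vec Bool L) m → Protocol k n O) x →
                   bits (writeInTurn m ρ f vis K) x ≡ m * L + bits (K (tabulate (λ j → f j x))) x
bits-writeInTurn zero    ρ f vis K x = refl
bits-writeInTurn {L = L} (suc m) ρ f vis K x =
  trans (bits-writeBits (ρ zero) (f zero) (vis zero) _ x)
    (trans (cong (L +_)
             (bits-writeInTurn m (ρ ∘ suc) (f ∘ suc) (vis ∘ suc) (K ∘ (f zero x ∷_)) x))
           (sym (+-assoc L (m * L) _)))

-- Player i checks only its own bits: it cannot evaluate another player's bit function.
agrees : Fin k → Fin k → (Input k n → Bool) → Bool → Input k n → Bool
agrees i j b h x = if does (j ≟ᶠ i) then does (b x ≟ᵇ h) else true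

agrees-self : ∀ (i : Fin k) b h (x : Input k n) → T (agrees i i b h x) → b x ≡ h
agrees-self i b h x a with i ≟ᶠ i
... | no i≢i = ⊥-elim (i≢i refl)
... | yes _ with b x ≟ᵇ h
...   | yes bx≡h = bx≡h

agrees-actual : ∀ (i j : Fin k) b h (x : Input k n) → b x ≡ h → T (agrees i j b h x)
agrees-actual i j b h x bx≡h with j ≟ᶠ i
... | no _ = tt
... | yes _ with b x ≟ᵇ h
...   | yes _    = tt
...   | no bx≢h = bx≢h bx≡h

agrees-visible : ∀ (i j : Fin k) b h → Visible j b → Visible {n = n} i (agrees i j b h)
agrees-visible i j b h v x y e with j ≟ᶠ i
... | no _      = refl
... | yes refl = cong (λ a → does (a ≟ᵇ h)) (v x y e)

follows : Fin k → Protocol k n O → Vec Bool m → Input k n → Bool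
follows i (leaf _)         r           x = true
follows i (node j b v t f) []          x = false
follows i (node j b v t f) (true ∷ r)  x = agrees i j b true x ∧ follows i t r x
follows i (node j b v t f) (false ∷ r) x = agrees i j b false x ∧ follows i f r x

-- The output at the leaf the string leads to; the default if it is too short.
outcome : O → Protocol k n O → Vec Bool m → O
outcome d (leaf o)         r           = o
outcome d (node j b v t f) []          = d
outcome d (node j b v t f) (true ∷ r)  = outcome d t r
outcome d (node j b v t f) (false ∷ r) = outcome d f r

follows-visible : ∀ (i : Fin k) (P : Protocol k n O) (r : Vec Bool m) → Visible i (follows i P r)
follows-visible i (leaf _)         r           x y e = refl
follows-visible i (node j b v t f) []          x y e = refl
follows-visible i (node j b v t f) (true ∷ r)  x y e =
  cong₂ _∧_ (agrees-visible i j b true v x y e) (follows-visible i t r x y e)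
follows-visible i (node j b v t f) (false ∷ r) x y e =
  cong₂ _∧_ (agrees-visible i j b false v x y e) (follows-visible i f r x y e)

-- Each node is checked by the player who writes there.
followed-outcome : ∀ d (P : Protocol k n O) (r : Vec Bool m) x →
                   (∀ i → T (follows i P r x)) → outcome d P r ≡ run P x
followed-outcome d (leaf o)         r           x all = refl
followed-outcome d (node j b v t f) []          x all = ⊥-elim (all j)
followed-outcome d (node j b v t f) (true ∷ r)  x all
  rewrite agrees-self j b true x (proj₁ (to T-∧ (all j))) =
  followed-outcome d t r x (proj₂ ∘ to T-∧ ∘ all)
followed-outcome d (node j b v t f) (false ∷ r) x all
  rewrite agrees-self j b false x (proj₁ (to T-∧ (all j))) =
  followed-outcome d f r x (proj₂ ∘ to T-∧ ∘ all)

transcript : ∀ (P : Protocol k n O) m x → bits P x ≤ m →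
             Σ (Vec Bool m) λ r → ∀ i → T (follows i P r x)
transcript (leaf o) m x _ = replicate m false , λ _ → tt
transcript (node j b v t f) m x le with b x in eq
transcript (node j b v t f) (suc m) x (s≤s le) | true =
  let r , fol = transcript t m x le
  in true ∷ r , λ i → from T-∧ (agrees-actual i j b true x eq , fol i)
transcript (node j b v t f) (suc m) x (s≤s le) | false =
  let r , fol = transcript f m x le
  in false ∷ r , λ i → from T-∧ (agrees-actual i j b false x eq , fol i)

Accepted : (Fin k → Vec Bool c → Input k n → Bool) → Input k n → Vec Bool c → Set
Accepted accepts x w = ∀ i → T (accepts i w x)

record Certificates (A : Input k n → Fin N) (S : Input k n → Set) (c : ℕ) : Set where
  field
    accepts         : Fin k → Vec Bool c → Input k n → Bool
    accepts-visible : ∀ i w → Visible i (accepts i w)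
    label           : Vec Bool c → Maybe (Fin N)
    sound           : ∀ x → S x → ∀ w → Accepted accepts x w →
                      label w ≡ nothing ⊎ label w ≡ just (A x)
    complete        : ∀ x → S x → ∃ λ w → Accepted accepts x w × label w ≡ just (A x)

module _ {A : Input k n → Fin N} {S : Input k n → Set} where

  certificates-of-empty : (∀ x → ¬ S x) → Certificates A S c
  certificates-of-empty empty = record
    { accepts         = λ _ _ _ → false
    ; accepts-visible = λ _ _ _ _ _ → refl
    ; label           = λ _ → nothing
    ; sound           = λ x s → ⊥-elim (empty x s)
    ; complete        = λ x s → ⊥-elim (empty x s)
    }

  transcriptCertificates : (P : NProtocol k n N) →
                           NondetSolves A S P (proofLen P + m) → Certificates A S (proofLen P + m)
  transcriptCertificates {m = m} P solves = record
    { accepts         = accepts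
    ; accepts-visible = λ i w → follows-visible i (protocolOf w) (transcriptOf w)
    ; label           = label
    ; sound           = sound
    ; complete        = complete
    }
    where
      p = proofLen P

      protocolOf : Vec Bool (p + m) → Protocol k n (Maybe (Fin N))
      protocolOf w = prot P (take p w)

      transcriptOf : Vec Bool (p + m) → Vec Bool m
      transcriptOf = drop p

      accepts : Fin k → Vec Bool (p + m) → Input k n → Bool
      accepts i w = follows i (protocolOf w) (transcriptOf w)

      label : Vec Bool (p + m) → Maybe (Fin N)
      label w = outcome nothing (protocolOf w) (transcriptOf w)

      sound : ∀ x → S x → ∀ w → Accepted accepts x w →
              label w ≡ nothing ⊎ label w ≡ just (A x)
      sound x s w acc rewrite followed-outcome nothing (protocolOf w) (transcriptOf w) x acc =
        proj₁ (proj₁ (solves x s) (take p w))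

      complete : ∀ x → S x → ∃ λ w → Accepted accepts x w × label w ≡ just (A x)
      complete x s with solves x s
      ... | everyProof , π , runs
          with transcript (prot P π) m x (+-cancelˡ-≤ p _ _ (proj₂ (everyProof π)))
      ...   | r , followed = π ++ r , accepted , labelled
        where
          accepted : Accepted accepts x (π ++ r)
          accepted rewrite take-++ π r | drop-++ π r = followed
          labelled : label (π ++ r) ≡ just (A x)
          labelled rewrite take-++ π r | drop-++ π r =
            trans (followed-outcome nothing (prot P π) r x followed) runs

  -- A proof longer than c cannot occur on S, so then S is empty.
  nondet⇒certificates : (P : NProtocol k n N) → NondetSolves A S P c → Certificates A S c
  nondet⇒certificates {c = c} P solves with proofLen P ≤? c
  ... | yes p≤c =
    let m , p+m≡c = m≤n⇒∃[o]m+o≡n p≤c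
    in subst (Certificates A S) p+m≡c
         (transcriptCertificates P (subst (NondetSolves A S P) (sym p+m≡c) solves))
  ... | no p≰c = certificates-of-empty λ x s →
    p≰c (≤-trans (m≤m+n _ _) (proj₂ (proj₁ (solves x s) (replicate _ false))))

module _ {A : Input (suc k) n → Fin (suc N)} {S : Input (suc k) n → Set}
         (C : Certificates A S c) where

  open Certificates C

  acceptanceTable : Fin k → Input (suc k) n → Vec Bool (2 ^ c)
  acceptanceTable j x = table c (λ w → accepts (suc j) w x)

  acceptanceTables : Input (suc k) n → Vec (Vec Bool (2 ^ c)) k
  acceptanceTables x = tabulate (λ j → acceptanceTable j x)

  admissible : Vec (Vec Bool (2 ^ c)) k → Input (suc k) n → Vec Bool c → Bool
  admissible ts x w = allᵇ (λ t → entry c t w) ts ∧ (accepts zero w x ∧ is-just (label w))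

  admissible-accepted : ∀ x w → T (admissible (acceptanceTables x) x w) →
                        Accepted accepts x w × T (is-just (label w))
  admissible-accepted x w adm = accepted , labelled
    where
      tabulated = to T-∧ adm
      own = to T-∧ (proj₂ tabulated)
      labelled = proj₂ own
      accepted : Accepted accepts x w
      accepted zero    = proj₁ own
      accepted (suc j) =
        subst T (entry-table c _ w)
          (allᵇ-tabulate (λ t → entry c t w) (λ j → acceptanceTable j x) (proj₁ tabulated) j)

  accepted-admissible : ∀ x w → Accepted accepts x w → T (is-just (label w)) →
                        T (admissible (acceptanceTables x) x w)
  accepted-admissible x w accepted labelled =
    from T-∧ (tabulate-allᵇ _ _ (λ j → subst T (sym (entry-table c _ w)) (accepted (suc j))) ,
              from T-∧ (accepted zero , labelled))

  acceptanceTable-visible : ∀ j → ComputableBy (suc j) (acceptanceTable j)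
  acceptanceTable-visible j x y e = table-cong c λ w → accepts-visible (suc j) w x y e

  chosen : Vec (Vec Bool (2 ^ c)) k → Input (suc k) n → Vec Bool c
  chosen ts x = choose (admissible ts x)

  chosen-visible : ∀ ts → ComputableBy zero (chosen ts)
  chosen-visible ts x y e = choose-cong λ w →
    cong (λ a → allᵇ (λ t → entry c t w) ts ∧ (a ∧ is-just (label w))) (accepts-visible zero w x y e)

  announce : Vec Bool c → Protocol (suc k) n (Fin (suc N))
  announce w = leaf (fromMaybe zero (label w))

  writeChosen : Vec (Vec Bool (2 ^ c)) k → Protocol (suc k) n (Fin (suc N))
  writeChosen ts = writeBits zero (chosen ts) (chosen-visible ts) announce

  simulation : Protocol (suc k) n (Fin (suc N))
  simulation = writeInTurn k suc acceptanceTable acceptanceTable-visible writeChosen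

  run-simulation : ∀ x → run simulation x ≡ fromMaybe zero (label (chosen (acceptanceTables x) x))
  run-simulation x =
    trans (run-writeInTurn k suc acceptanceTable acceptanceTable-visible writeChosen x)
          (run-writeBits zero (chosen ts) (chosen-visible ts) announce x)
    where ts = acceptanceTables x

  bits-simulation : ∀ x → bits simulation x ≡ k * 2 ^ c + c
  bits-simulation x =
    trans (bits-writeInTurn k suc acceptanceTable acceptanceTable-visible writeChosen x)
          (cong (k * 2 ^ c +_) (trans (bits-writeBits zero (chosen ts) (chosen-visible ts) announce x)
                                      (+-identityʳ c)))
    where ts = acceptanceTables x

  labelled-correct : ∀ x → S x → ∀ w → Accepted accepts x w → T (is-just (label w)) →
                     label w ≡ just (A x)
  labelled-correct x s w accepted labelled with sound x s w accepted
  ... | inj₁ unlabelled = ⊥-elim (subst (T ∘ is-just) unlabelled labelled)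
  ... | inj₂ correct    = correct

  chosen-label : ∀ x → S x → label (chosen (acceptanceTables x) x) ≡ just (A x)
  chosen-label x s with complete x s
  ... | w₀ , accepted₀ , labelled₀ = labelled-correct x s w (proj₁ admitted) (proj₂ admitted)
    where
      w = chosen (acceptanceTables x) x
      admitted = admissible-accepted x w
        (choose-spec (admissible (acceptanceTables x) x) w₀
          (accepted-admissible x w₀ accepted₀ (subst (T ∘ is-just) (sym labelled₀) tt)))

  certificates⇒detCost : HasDetCost A S (k * 2 ^ c + c)
  certificates⇒detCost =
    simulation , λ x s →
      trans (run-simulation x) (cong (fromMaybe zero) (chosen-label x s)) ,
      ≤-reflexive (bits-simulation x)

lemma10 : (k n N : ℕ) → 2 ≤ k → 1 ≤ n → 1 ≤ N →
    (A : Input k n → Fin N) (S : Input k n → Set) (d c : ℕ) →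
    IsD A S d → IsN A S c →
    d ≤ (k ∸ 1) * 2 ^ c + c
lemma10 _ n _ (s≤s _) _ (s≤s _) A S d c (_ , minimal) ((P , solves) , _) =
  minimal _ (certificates⇒detCost (nondet⇒certificates P solves))
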